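{- Let $s\ge1$, $t\ge 2$, $G\in\mathcal{G}_{s,t}$ with root $r$, and let $C$ be a non-trivial configuration with $k$ pebble-free vertices in $S$. If $k$ is even, $C_T=k+2$, and either there is at least one $x\in T$ with $C(x)=0$ or there are at least two vertices $x,y\in T$ with $C(x)$ and $C(y)$ even, then Defender has a winning strategy.
   Context: A configuration $C$ on a graph $G$ is a function $C:V(G)\to\mathbb{Z}_{\ge 0}$. A pebbling move removes two pebbles from a vertex and places one pebble on an adjacent vertex. The Two-Player Pebbling Game on $G$ with root $r$ and starting configuration $C$ is played by Mover and Defender in rounds: in each round Mover makes a pebbling move and then Defender makes a pebbling move; each player must take their turn. If Mover pebbles from $u$ to $v$, Defender may not pebble from $v$ to $u$ in the same round. Mover wins if at any time the root has at least one pebble; Defender wins if the root has no pebble and there are no more pebbling moves. A winning strategy is a rule choosing a player's moves as a function of the current position which guarantees that player wins. For integers $s,t\ge1$, $\mathcal{G}_{s,t}$ is the class of all graphs $(K_1\cup \overline{K_t})\vee H$, where $H$ is any graph on $s$ vertices, $\overline{K_t}$ is the edgeless graph on $t$ vertices, $\cup$ is disjoint union and $\vee$ is the join. The root $r$ is the vertex of $K_1$; $S=V(H)$, $T=V(\overline{K_t})$. A configuration is non-trivial if each vertex of $S$ has 0 or 1 pebbles and the root has no pebbles. A vertex is pebble-free if it has no pebbles. $k$ is the number of pebble-free vertices of $S$, and $C_T=\sum_{v\in T}\lfloor C(v)/2\rfloor$. -}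

module Defs where

open import Data.Nat using (ℕ; zero; suc; _+_; _∸_; _≤_; ⌊_/2⌋)
open import Data.Fin using (Fin)
import Data.Fin as Fin
open import Data.List using (List; tabulate)
open import Data.Nat.ListAction using (sum)
open import Data.Product using (Σ; _×_; _,_)
open import Data.Empty using (⊥)
open import Data.Unit using (⊤)
open import Relation.Nullary using (¬_; yes; no; Dec)
open import Relation.Binary.PropositionalEquality using (_≡_; refl; cong)

record SimpleGraph (n : ℕ) : Set₁ where
  field
    Adj     : Fin n → Fin n → Set
    symm    : ∀ {i j} → Adj i j → Adj j i
    irrefl  : ∀ {i} → ¬ Adj i i

-- Vertices of G = (K₁ ∪ K̄_t) ∨ H : the root r, the s vertices of S = V(H),
-- and the t vertices of T = V(K̄_t).

data Vtx (s t : ℕ) : Set where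
  root : Vtx s t
  sv   : Fin s → Vtx s t
  tv   : Fin t → Vtx s t

_≟V_ : ∀ {s t} (u v : Vtx s t) → Dec (u ≡ v)
root ≟V root = yes refl
root ≟V sv _ = no λ ()
root ≟V tv _ = no λ ()
sv _ ≟V root = no λ ()
sv i ≟V sv j with i Fin.≟ j
... | yes refl = yes refl
... | no i≢j = no λ { refl → i≢j refl }
sv _ ≟V tv _ = no λ ()
tv _ ≟V root = no λ ()
tv _ ≟V sv _ = no λ ()
tv i ≟V tv j with i Fin.≟ j
... | yes refl = yes refl
... | no i≢j = no λ { refl → i≢j refl }

Adj : ∀ {s t} → SimpleGraph s → Vtx s t → Vtx s t → Set
Adj H root   root   = ⊥
Adj H root   (sv _) = ⊤
Adj H root   (tv _) = ⊥
Adj H (sv _) root   = ⊤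
Adj H (sv i) (sv j) = SimpleGraph.Adj H i j
Adj H (sv _) (tv _) = ⊤
Adj H (tv _) root   = ⊥
Adj H (tv _) (sv _) = ⊤
Adj H (tv _) (tv _) = ⊥

Config : ℕ → ℕ → Set
Config s t = Vtx s t → ℕ

Move : ℕ → ℕ → Set
Move s t = Vtx s t × Vtx s t

Legal : ∀ {s t} → SimpleGraph s → Config s t → Move s t → Set
Legal H C (u , v) = Adj H u v × (2 ≤ C u)

ind : ∀ {s t} → Vtx s t → Vtx s t → ℕ → ℕ
ind w u n with w ≟V u
... | yes _ = n
... | no _  = 0

apply : ∀ {s t} → Move s t → Config s t → Config s t
apply (u , v) C w = (C w ∸ ind w u 2) + ind w v 1

rev : ∀ {s t} → Move s t → Move s t
rev (u , v) = (v , u)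

-- Since every move decreases the total
-- number of pebbles, the game is finite, and "Defender has a winning
-- strategy from a position" is the least predicate closed under the rules:
--
--  * DefWinsM H C   : Mover is to move in configuration C.
--                     The root is pebble-free, and after every legal Mover
--                     move m Defender wins the resulting position (if Mover
--                     has no legal move, the game is over and Defender wins).
--  * DefWinsD H C m : Defender is to move in configuration C, Mover having
--                     just played m.

mutual
  data DefWinsM {s t} (H : SimpleGraph s) (C : Config s t) : Set where
    defM : C root ≡ 0 →
           (∀ m → Legal H C m → DefWinsD H (apply m C) m) →
           DefWinsM H C

  data DefWinsD {s t} (H : SimpleGraph s) (C : Config s t) (m : Move s t) : Set where
    stuck : C root ≡ 0 →
            (∀ d → Legal H C d → d ≡ rev m) →
            DefWinsD H C m
    play  : C root ≡ 0 →
            (d : Move s t) → Legal H C d → ¬ (d ≡ rev m) →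
            DefWinsM H (apply d C) →
            DefWinsD H C m

DefenderWins : ∀ {s t} → SimpleGraph s → Config s t → Set
DefenderWins H C = DefWinsM H C

NonTrivial : ∀ {s t} → Config s t → Set
NonTrivial {s} C = (C root ≡ 0) × (∀ (i : Fin s) → C (sv i) ≤ 1)

isZero : ℕ → ℕ
isZero zero    = 1
isZero (suc _) = 0

kFree : ∀ {s t} → Config s t → ℕ
kFree {s} C = sum (tabulate {n = s} (λ i → isZero (C (sv i))))

CT : ∀ {s t} → Config s t → ℕ
CT {s} {t} C = sum (tabulate {n = t} (λ j → ⌊ C (tv j) /2⌋))

module Submission where

-- In a non-trivial configuration the root is empty and
-- every vertex of S holds at most one pebble, so Mover can only move from a
-- vertex j ∈ T with at least two pebbles to a vertex i ∈ S.  Defender answers: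
--
--  * if i was empty, by another move from T into a (still) empty vertex of S,
--    or, if no vertex of T can move any more, the game is over;
--  * if i already held a pebble (and now holds two), by moving from i back to
--    some w ∈ T with w ≠ j, choosing w with an even number of pebbles when the
--    budget below requires it.
--
-- Either way the position is non-trivial again, and C_T stays within a budget
-- depending on k: C_T ≤ allowance k, where allowance k is k + 1 for even k and
-- k for odd k, or C_T ≤ allowance⁺ k (k + 2 for even k) provided T has an
-- empty vertex or two vertices with an even number of pebbles.  Every round
-- strictly decreases the number of pebbles on T, so induction on that number
-- shows that Defender wins from every position meeting the budget.

open import Defs
open import Data.Nat using (ℕ; _≤_; _+_)
open import Data.Nat.Divisibility using (_∣_)
open import Data.Fin using (Fin)
open import Data.Product using (Σ; _×_)
open import Data.Sum using (_⊎_)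
open import Relation.Nullary using (¬_)
open import Relation.Binary.PropositionalEquality using (_≡_)

open import Data.Nat using (zero; suc; _∸_; _*_; _<_; ⌊_/2⌋; z≤n; s≤s; _≤?_)
open import Data.Nat.Properties
  using (≤-refl; ≤-reflexive; ≤-trans; ≤-pred; m≤m+n; m≤n+m; m≤n⇒m≤1+n; n<1+n; m<n+m;
         +-assoc; +-comm; +-identityʳ; +-cancelˡ-≤; m+[n∸m]≡n; ⌊n/2⌋-mono; module ≤-Reasoning)
open import Data.Nat.Divisibility using (divides; ∣-refl; ∣m+n∣m⇒∣n)
open import Data.Nat.Induction using (<-wellFounded)
open import Data.Nat.ListAction using (sum)
open import Data.List using (tabulate)
open import Data.List.Properties using (tabulate-cong)
open import Data.Fin using () renaming (zero to fzero; suc to fsuc)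
open import Data.Fin.Properties using (any?; suc-injective) renaming (_≟_ to _≟F_)
open import Data.Product using (_,_; ∃; proj₁; proj₂)
open import Data.Sum using (inj₁; inj₂)
open import Data.Unit using (tt)
open import Function using (_∘_)
open import Induction.WellFounded using (Acc; acc)
open import Relation.Nullary using (Dec; yes; no; contradiction)
open import Relation.Binary.PropositionalEquality
  using (refl; sym; trans; cong; cong₂; subst; subst₂; module ≡-Reasoning)

total : ∀ {n} → (Fin n → ℕ) → ℕ
total f = sum (tabulate f)

total-update : ∀ {n} (f g : Fin n → ℕ) (j : Fin n) (d : ℕ) →
               (∀ i → ¬ i ≡ j → g i ≡ f i) → g j ≡ d + f j → total g ≡ d + total f
total-update f g fzero d same changed = begin
  g fzero + total (g ∘ fsuc)  ≡⟨ cong₂ _+_ changed (cong sum (tabulate-cong λ i → same (fsuc i) λ ())) ⟩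
  d + f fzero + total (f ∘ fsuc) ≡⟨ +-assoc d (f fzero) _ ⟩
  d + total f                 ∎
  where open ≡-Reasoning
total-update f g (fsuc j) d same changed = begin
  g fzero + total (g ∘ fsuc)      ≡⟨ cong₂ _+_ (same fzero λ ()) rest ⟩
  f fzero + (d + total (f ∘ fsuc)) ≡⟨ +-assoc (f fzero) d _ ⟨
  f fzero + d + total (f ∘ fsuc)   ≡⟨ cong (_+ total (f ∘ fsuc)) (+-comm (f fzero) d) ⟩
  d + f fzero + total (f ∘ fsuc)   ≡⟨ +-assoc d (f fzero) _ ⟩
  d + total f                     ∎
  where
  open ≡-Reasoning
  rest : total (g ∘ fsuc) ≡ d + total (f ∘ fsuc)
  rest = total-update (f ∘ fsuc) (g ∘ fsuc) j d (λ i i≢j → same (fsuc i) (i≢j ∘ suc-injective)) changed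

entry≤total : ∀ {n} (f : Fin n → ℕ) (j : Fin n) → f j ≤ total f
entry≤total f fzero    = m≤m+n (f fzero) _
entry≤total f (fsuc j) = ≤-trans (entry≤total (f ∘ fsuc) j) (m≤n+m _ (f fzero))

total-positive : ∀ {n} (f : Fin n → ℕ) → 1 ≤ total f → ∃ λ i → 1 ≤ f i
total-positive {suc n} f pos with f fzero in eq
... | suc _ = fzero , subst (1 ≤_) (sym eq) (s≤s z≤n)
... | zero with total-positive (f ∘ fsuc) pos
...   | i , fi-pos = fsuc i , fi-pos

other-index : ∀ {n} → 2 ≤ n → (j : Fin n) → Σ (Fin n) λ w → ¬ w ≡ j
other-index (s≤s (s≤s _)) fzero    = fsuc fzero , λ ()
other-index (s≤s (s≤s _)) (fsuc _) = fzero , λ ()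

isZero-positive : ∀ {c} → 1 ≤ isZero c → c ≡ 0
isZero-positive {zero} _ = refl

≤1-cases : ∀ {c} → c ≤ 1 → c ≡ 0 ⊎ c ≡ 1
≤1-cases z≤n       = inj₁ refl
≤1-cases (s≤s z≤n) = inj₂ refl

half-minus2 : ∀ {c} → 2 ≤ c → ⌊ c /2⌋ ≡ suc ⌊ c ∸ 2 /2⌋
half-minus2 {suc (suc c)} (s≤s (s≤s _)) = refl

half-plus1 : ∀ c → ⌊ c + 1 /2⌋ ≡ ⌊ c /2⌋ ⊎ ⌊ c + 1 /2⌋ ≡ suc ⌊ c /2⌋
half-plus1 zero          = inj₁ refl
half-plus1 (suc zero)    = inj₂ refl
half-plus1 (suc (suc c)) with half-plus1 c
... | inj₁ eq = inj₁ (cong suc eq)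
... | inj₂ eq = inj₂ (cong suc eq)

half-plus1-even : ∀ {c} → 2 ∣ c → ⌊ c + 1 /2⌋ ≡ ⌊ c /2⌋
half-plus1-even (divides q refl) = go q
  where
  go : ∀ q → ⌊ q * 2 + 1 /2⌋ ≡ ⌊ q * 2 /2⌋
  go zero    = refl
  go (suc q) = cong suc (go q)

even-minus2 : ∀ {c} → 2 ≤ c → 2 ∣ c → 2 ∣ c ∸ 2
even-minus2 two≤c even = ∣m+n∣m⇒∣n (subst (2 ∣_) (sym (m+[n∸m]≡n two≤c)) even) ∣-refl

-- The budget for C_T with k pebble-free vertices in S:
-- allowance k is k + 1 for even k and k for odd k;
-- allowance⁺ k is k + 2 for even k and k for odd k.
allowance : ℕ → ℕ
allowance zero          = 1
allowance (suc zero)    = 1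
allowance (suc (suc k)) = 2 + allowance k

allowance⁺ : ℕ → ℕ
allowance⁺ zero          = 2
allowance⁺ (suc zero)    = 1
allowance⁺ (suc (suc k)) = 2 + allowance⁺ k

allowance≤allowance⁺ : ∀ k → allowance k ≤ allowance⁺ k
allowance≤allowance⁺ zero          = s≤s z≤n
allowance≤allowance⁺ (suc zero)    = ≤-refl
allowance≤allowance⁺ (suc (suc k)) = s≤s (s≤s (allowance≤allowance⁺ k))

allowance-step : ∀ k → allowance k ≤ allowance (suc k)
allowance-step zero          = ≤-refl
allowance-step (suc zero)    = s≤s z≤n
allowance-step (suc (suc k)) = s≤s (s≤s (allowance-step k))

-- one more pebble-free vertex and one less unit of C_T turn the enlarged
-- budget into the plain one
allowance⁺-step : ∀ k → allowance⁺ k ≤ suc (allowance (suc k))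
allowance⁺-step zero          = ≤-refl
allowance⁺-step (suc zero)    = s≤s z≤n
allowance⁺-step (suc (suc k)) = s≤s (s≤s (allowance⁺-step k))

-- with a single pebble-free vertex the budget is one, so C_T ≥ 2 forces more
allowance⁺-room : ∀ k → 2 ≤ allowance⁺ (suc k) → 1 ≤ k
allowance⁺-room zero    (s≤s ())
allowance⁺-room (suc k) _        = s≤s z≤n

-- the hypotheses of the theorem say C_T = allowance⁺ k
allowance⁺-even : ∀ {k} → 2 ∣ k → allowance⁺ k ≡ k + 2
allowance⁺-even (divides q refl) = go q
  where
  go : ∀ q → allowance⁺ (q * 2) ≡ q * 2 + 2
  go zero    = refl
  go (suc q) = cong (2 +_) (go q)

module _ {s t : ℕ} where

  ind-self : ∀ (u : Vtx s t) n → ind u u n ≡ n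
  ind-self u n with u ≟V u
  ... | yes _   = refl
  ... | no u≢u = contradiction refl u≢u

  ind-other : ∀ (w u : Vtx s t) n → ¬ w ≡ u → ind w u n ≡ 0
  ind-other w u n w≢u with w ≟V u
  ... | yes w≡u = contradiction w≡u w≢u
  ... | no _    = refl

  apply-source : ∀ (u v : Vtx s t) C → ¬ u ≡ v → apply (u , v) C u ≡ C u ∸ 2
  apply-source u v C u≢v =
    trans (cong₂ (λ a b → C u ∸ a + b) (ind-self u 2) (ind-other u v 1 u≢v)) (+-identityʳ _)

  apply-target : ∀ (u v : Vtx s t) C → ¬ u ≡ v → apply (u , v) C v ≡ C v + 1
  apply-target u v C u≢v =
    cong₂ (λ a b → C v ∸ a + b) (ind-other v u 2 (u≢v ∘ sym)) (ind-self v 1)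

  apply-other : ∀ (u v w : Vtx s t) C → ¬ w ≡ u → ¬ w ≡ v → apply (u , v) C w ≡ C w
  apply-other u v w C w≢u w≢v =
    trans (cong₂ (λ a b → C w ∸ a + b) (ind-other w u 2 w≢u) (ind-other w v 1 w≢v)) (+-identityʳ _)

  sv-≢ : ∀ {i i′ : Fin s} → ¬ i′ ≡ i → ¬ sv {s} {t} i′ ≡ sv i
  sv-≢ i′≢i refl = i′≢i refl

  tv-≢ : ∀ {j j′ : Fin t} → ¬ j′ ≡ j → ¬ tv {s} {t} j′ ≡ tv j
  tv-≢ j′≢j refl = j′≢j refl

  pebblesT : Config s t → ℕ
  pebblesT C = total (λ j → C (tv j))

  EvenReserve : Config s t → Set
  EvenReserve C = (Σ (Fin t) λ x → C (tv x) ≡ 0) ⊎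
                  (Σ (Fin t) λ x → Σ (Fin t) λ y → ¬ (x ≡ y) × (2 ∣ C (tv x)) × (2 ∣ C (tv y)))

  reserve-escape : ∀ {C} → EvenReserve C → ∀ j → 2 ≤ C (tv j) →
                   Σ (Fin t) λ w → ¬ w ≡ j × 2 ∣ C (tv w)
  reserve-escape (inj₁ (x , empty)) j rich =
    x , (λ { refl → contradiction (subst (2 ≤_) empty rich) λ () }) , subst (2 ∣_) (sym empty) (divides 0 refl)
  reserve-escape (inj₂ (x , y , x≢y , even-x , even-y)) j rich with x ≟F j
  ... | yes refl = y , (λ y≡x → x≢y (sym y≡x)) , even-y
  ... | no x≢j   = x , x≢j , even-x

  legal-nonTrivial : ∀ (H : SimpleGraph s) {C} → NonTrivial C → ∀ m → Legal H C m →
                     Σ (Fin t) λ j → Σ (Fin s) λ i → m ≡ (tv j , sv i) × 2 ≤ C (tv j)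
  legal-nonTrivial H (root-empty , _) (root , _) (_ , rich) =
    contradiction (subst (2 ≤_) root-empty rich) λ ()
  legal-nonTrivial H (_ , at-most-one) (sv i , _) (_ , rich) =
    contradiction (≤-trans rich (at-most-one i)) λ { (s≤s ()) }
  legal-nonTrivial H _ (tv j , sv i) (_ , rich) = j , i , refl , rich

  module Fill (C : Config s t) (j : Fin t) (i : Fin s) (rich : 2 ≤ C (tv j)) where

    C′ : Config s t
    C′ = apply (tv j , sv i) C

    root-same : C′ root ≡ C root
    root-same = apply-other (tv j) (sv i) root C (λ ()) (λ ())

    S-other : ∀ i′ → ¬ i′ ≡ i → C′ (sv i′) ≡ C (sv i′)
    S-other i′ i′≢i = apply-other (tv j) (sv i) (sv i′) C (λ ()) (sv-≢ i′≢i)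

    S-target : C′ (sv i) ≡ C (sv i) + 1
    S-target = apply-target (tv j) (sv i) C (λ ())

    T-other : ∀ j′ → ¬ j′ ≡ j → C′ (tv j′) ≡ C (tv j′)
    T-other j′ j′≢j = apply-other (tv j) (sv i) (tv j′) C (tv-≢ j′≢j) (λ ())

    T-source : C′ (tv j) ≡ C (tv j) ∸ 2
    T-source = apply-source (tv j) (sv i) C (λ ())

    CT-drop : CT C ≡ suc (CT C′)
    CT-drop = total-update (λ j′ → ⌊ C′ (tv j′) /2⌋) (λ j′ → ⌊ C (tv j′) /2⌋) j 1
                (λ j′ j′≢j → cong ⌊_/2⌋ (sym (T-other j′ j′≢j)))
                (trans (half-minus2 rich) (cong (λ c → suc ⌊ c /2⌋) (sym T-source)))

    pebblesT-drop : pebblesT C ≡ 2 + pebblesT C′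
    pebblesT-drop = total-update (λ j′ → C′ (tv j′)) (λ j′ → C (tv j′)) j 2
                      (λ j′ j′≢j → sym (T-other j′ j′≢j))
                      (trans (sym (m+[n∸m]≡n rich)) (cong (2 +_) (sym T-source)))

    reserve-kept : EvenReserve C → EvenReserve C′
    reserve-kept (inj₁ (x , empty)) = inj₁ (x , trans (T-other x x≢j) empty)
      where
      x≢j : ¬ x ≡ j
      x≢j refl = contradiction (subst (2 ≤_) empty rich) λ ()
    reserve-kept (inj₂ (x , y , x≢y , even-x , even-y)) =
      inj₂ (x , y , x≢y , even-kept x even-x , even-kept y even-y)
      where
      even-kept : ∀ x → 2 ∣ C (tv x) → 2 ∣ C′ (tv x)
      even-kept x even = by-cases (x ≟F j)
        where
        by-cases : Dec (x ≡ j) → 2 ∣ C′ (tv x)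
        by-cases (yes refl) = subst (2 ∣_) (sym T-source) (even-minus2 rich even)
        by-cases (no x≢j)   = subst (2 ∣_) (sym (T-other x x≢j)) even

    module _ (empty : C (sv i) ≡ 0) where

      filled : C′ (sv i) ≡ 1
      filled = trans S-target (cong (_+ 1) empty)

      kFree-fillEmpty : kFree C ≡ suc (kFree C′)
      kFree-fillEmpty = total-update (λ i′ → isZero (C′ (sv i′))) (λ i′ → isZero (C (sv i′))) i 1
                          (λ i′ i′≢i → cong isZero (sym (S-other i′ i′≢i)))
                          (trans (cong isZero empty) (cong (λ c → 1 + isZero c) (sym filled)))

      nonTrivial-fillEmpty : NonTrivial C → NonTrivial C′
      nonTrivial-fillEmpty (root-empty , at-most-one) = trans root-same root-empty , bound
        where
        bound : ∀ i′ → C′ (sv i′) ≤ 1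
        bound i′ = by-cases (i′ ≟F i)
          where
          by-cases : Dec (i′ ≡ i) → C′ (sv i′) ≤ 1
          by-cases (yes refl) = ≤-reflexive filled
          by-cases (no i′≢i)  = subst (_≤ 1) (sym (S-other i′ i′≢i)) (at-most-one i′)

    module _ (single : C (sv i) ≡ 1) where

      doubled : C′ (sv i) ≡ 2
      doubled = trans S-target (cong (_+ 1) single)

      kFree-fillSingle : kFree C′ ≡ kFree C
      kFree-fillSingle = total-update (λ i′ → isZero (C (sv i′))) (λ i′ → isZero (C′ (sv i′))) i 0
                           (λ i′ i′≢i → cong isZero (S-other i′ i′≢i))
                           (trans (cong isZero doubled) (cong isZero (sym single)))

  module Spill (C : Config s t) (i : Fin s) (w : Fin t) (two : C (sv i) ≡ 2) where

    C′ : Config s t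
    C′ = apply (sv i , tv w) C

    root-same : C′ root ≡ C root
    root-same = apply-other (sv i) (tv w) root C (λ ()) (λ ())

    S-other : ∀ i′ → ¬ i′ ≡ i → C′ (sv i′) ≡ C (sv i′)
    S-other i′ i′≢i = apply-other (sv i) (tv w) (sv i′) C (sv-≢ i′≢i) (λ ())

    emptied : C′ (sv i) ≡ 0
    emptied = trans (apply-source (sv i) (tv w) C (λ ())) (cong (_∸ 2) two)

    T-other : ∀ j′ → ¬ j′ ≡ w → C′ (tv j′) ≡ C (tv j′)
    T-other j′ j′≢w = apply-other (sv i) (tv w) (tv j′) C (λ ()) (tv-≢ j′≢w)

    T-target : C′ (tv w) ≡ C (tv w) + 1
    T-target = apply-target (sv i) (tv w) C (λ ())

    kFree-spill : kFree C′ ≡ suc (kFree C)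
    kFree-spill = total-update (λ i′ → isZero (C (sv i′))) (λ i′ → isZero (C′ (sv i′))) i 1
                    (λ i′ i′≢i → cong isZero (S-other i′ i′≢i))
                    (trans (cong isZero emptied) (cong (λ c → 1 + isZero c) (sym two)))

    pebblesT-spill : pebblesT C′ ≡ suc (pebblesT C)
    pebblesT-spill = total-update (λ j′ → C (tv j′)) (λ j′ → C′ (tv j′)) w 1
                       T-other (trans T-target (+-comm _ 1))

    CT-spill-by : ∀ d → ⌊ C (tv w) + 1 /2⌋ ≡ d + ⌊ C (tv w) /2⌋ → CT C′ ≡ d + CT C
    CT-spill-by d half = total-update (λ j′ → ⌊ C (tv j′) /2⌋) (λ j′ → ⌊ C′ (tv j′) /2⌋) w d
                           (λ j′ j′≢w → cong ⌊_/2⌋ (T-other j′ j′≢w))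
                           (trans (cong ⌊_/2⌋ T-target) half)

    CT-spill≤ : CT C′ ≤ suc (CT C)
    CT-spill≤ with half-plus1 (C (tv w))
    ... | inj₁ same  = m≤n⇒m≤1+n (≤-reflexive (CT-spill-by 0 same))
    ... | inj₂ raise = ≤-reflexive (CT-spill-by 1 raise)

    CT-spill-even : 2 ∣ C (tv w) → CT C′ ≡ CT C
    CT-spill-even even = CT-spill-by 0 (half-plus1-even even)

  data Budgeted (C : Config s t) : Set where
    plain    : CT C ≤ allowance (kFree C) → Budgeted C
    reserved : EvenReserve C → CT C ≤ allowance⁺ (kFree C) → Budgeted C

  within-allowance⁺ : ∀ {C} → Budgeted C → CT C ≤ allowance⁺ (kFree C)
  within-allowance⁺ {C} (plain within) = ≤-trans within (allowance≤allowance⁺ (kFree C))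
  within-allowance⁺ (reserved _ within) = within

  budgeted-drop2 : ∀ {C D} → Budgeted C → kFree C ≡ 2 + kFree D → CT C ≡ 2 + CT D →
                   (EvenReserve C → EvenReserve D) → Budgeted D
  budgeted-drop2 {C} {D} (plain within) k-drop CT-drop _ =
    plain (+-cancelˡ-≤ 2 _ _ (subst₂ _≤_ CT-drop (cong allowance k-drop) within))
  budgeted-drop2 {C} {D} (reserved reserve within) k-drop CT-drop keep =
    reserved (keep reserve) (+-cancelˡ-≤ 2 _ _ (subst₂ _≤_ CT-drop (cong allowance⁺ k-drop) within))

module Strategy {s t : ℕ} (H : SimpleGraph s) (t≥2 : 2 ≤ t) where

  record Safe (C : Config s t) : Set where
    constructor safe
    field
      nonTrivial : NonTrivial C
      budgeted   : Budgeted C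

  WinsBelow : Config s t → Set
  WinsBelow C = ∀ D → pebblesT D < pebblesT C → Safe D → DefWinsM H D

  replyToFill : ∀ {C} → Safe C → WinsBelow C → ∀ j i → (rich : 2 ≤ C (tv j)) → C (sv i) ≡ 0 →
                DefWinsD H (apply (tv j , sv i) C) (tv j , sv i)
  replyToFill {C} (safe nt bud) ih j i rich empty = reply (any? λ j′ → 2 ≤? C′ (tv j′))
    where
    open Fill C j i rich
    nt′ : NonTrivial C′
    nt′ = nonTrivial-fillEmpty empty nt

    reply : Dec (∃ λ j′ → 2 ≤ C′ (tv j′)) → DefWinsD H C′ (tv j , sv i)
    reply (no none-rich) = stuck (proj₁ nt′) λ d legal →
      let j′ , _ , _ , rich′ = legal-nonTrivial H {C′} nt′ d legal in contradiction (j′ , rich′) none-rich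
    reply (yes (j′ , rich′)) =
      play (proj₁ nt′) (tv j′ , sv i′) (tt , rich′) (λ ()) (ih C″ smaller (safe nt″ bud″))
      where
      CT′-positive : 1 ≤ CT C′
      CT′-positive = ≤-trans (⌊n/2⌋-mono rich′) (entry≤total (λ x → ⌊ C′ (tv x) /2⌋) j′)

      kFree′-positive : 1 ≤ kFree C′
      kFree′-positive = allowance⁺-room (kFree C′) (begin
        2                           ≤⟨ s≤s CT′-positive ⟩
        suc (CT C′)                 ≡⟨ CT-drop ⟨
        CT C                        ≤⟨ within-allowance⁺ bud ⟩
        allowance⁺ (kFree C)        ≡⟨ cong allowance⁺ (kFree-fillEmpty empty) ⟩
        allowance⁺ (suc (kFree C′)) ∎)
        where open ≤-Reasoning

      i′ : Fin s
      i′ = proj₁ (total-positive (λ x → isZero (C′ (sv x))) kFree′-positive)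

      empty′ : C′ (sv i′) ≡ 0
      empty′ = isZero-positive (proj₂ (total-positive (λ x → isZero (C′ (sv x))) kFree′-positive))

      module F = Fill C′ j′ i′ rich′
      C″ : Config s t
      C″ = F.C′

      nt″ : NonTrivial C″
      nt″ = F.nonTrivial-fillEmpty empty′ nt′

      bud″ : Budgeted C″
      bud″ = budgeted-drop2 bud
               (trans (kFree-fillEmpty empty) (cong suc (F.kFree-fillEmpty empty′)))
               (trans CT-drop (cong suc F.CT-drop))
               (F.reserve-kept ∘ reserve-kept)

      smaller : pebblesT C″ < pebblesT C
      smaller = begin-strict
        pebblesT C″             <⟨ m<n+m _ {4} (s≤s z≤n) ⟩
        2 + (2 + pebblesT C″)   ≡⟨ cong (2 +_) F.pebblesT-drop ⟨
        2 + pebblesT C′         ≡⟨ pebblesT-drop ⟨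
        pebblesT C              ∎
        where open ≤-Reasoning

  replyToSpill : ∀ {C} → Safe C → WinsBelow C → ∀ j i → (rich : 2 ≤ C (tv j)) → C (sv i) ≡ 1 →
                 DefWinsD H (apply (tv j , sv i) C) (tv j , sv i)
  replyToSpill {C} (safe (root-empty , at-most-one) bud) ih j i rich single = choose bud
    where
    open Fill C j i rich

    spillTo : (w : Fin t) → ¬ w ≡ j →
              CT C ≤ allowance (kFree C) ⊎ (2 ∣ C (tv w) × CT C ≤ allowance⁺ (kFree C)) →
              DefWinsD H C′ (tv j , sv i)
    spillTo w w≢j within =
      play root-empty′ (sv i , tv w) (tt , ≤-reflexive (sym (doubled single)))
           (λ { refl → w≢j refl }) (ih C″ smaller (safe nt″ (plain (budget″ within))))
      where
      module S = Spill C′ i w (doubled single)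
      C″ : Config s t
      C″ = S.C′

      root-empty′ : C′ root ≡ 0
      root-empty′ = trans root-same root-empty

      nt″ : NonTrivial C″
      nt″ = trans S.root-same root-empty′ , bound
        where
        bound : ∀ i′ → C″ (sv i′) ≤ 1
        bound i′ = by-cases (i′ ≟F i)
          where
          by-cases : Dec (i′ ≡ i) → C″ (sv i′) ≤ 1
          by-cases (yes refl) = subst (_≤ 1) (sym S.emptied) z≤n
          by-cases (no i′≢i)  = subst (_≤ 1) (sym (trans (S.S-other i′ i′≢i) (S-other i′ i′≢i))) (at-most-one i′)

      k″ : kFree C″ ≡ suc (kFree C)
      k″ = trans S.kFree-spill (cong suc (kFree-fillSingle single))

      budget″ : CT C ≤ allowance (kFree C) ⊎ (2 ∣ C (tv w) × CT C ≤ allowance⁺ (kFree C)) →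
                CT C″ ≤ allowance (kFree C″)
      budget″ (inj₁ plain-within) = begin
        CT C″                    ≤⟨ S.CT-spill≤ ⟩
        suc (CT C′)              ≡⟨ CT-drop ⟨
        CT C                     ≤⟨ plain-within ⟩
        allowance (kFree C)      ≤⟨ allowance-step (kFree C) ⟩
        allowance (suc (kFree C)) ≡⟨ cong allowance k″ ⟨
        allowance (kFree C″)     ∎
        where open ≤-Reasoning
      budget″ (inj₂ (even , within⁺)) = ≤-pred (begin
        suc (CT C″)                    ≡⟨ cong suc (S.CT-spill-even (subst (2 ∣_) (sym (T-other w w≢j)) even)) ⟩
        suc (CT C′)                    ≡⟨ CT-drop ⟨
        CT C                           ≤⟨ within⁺ ⟩
        allowance⁺ (kFree C)           ≤⟨ allowance⁺-step (kFree C) ⟩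
        suc (allowance (suc (kFree C))) ≡⟨ cong (suc ∘ allowance) k″ ⟨
        suc (allowance (kFree C″))     ∎)
        where open ≤-Reasoning

      smaller : pebblesT C″ < pebblesT C
      smaller = begin-strict
        pebblesT C″       ≡⟨ S.pebblesT-spill ⟩
        suc (pebblesT C′) <⟨ n<1+n _ ⟩
        2 + pebblesT C′   ≡⟨ pebblesT-drop ⟨
        pebblesT C        ∎
        where open ≤-Reasoning

    choose : Budgeted C → DefWinsD H C′ (tv j , sv i)
    choose (plain within) =
      let w , w≢j = other-index t≥2 j in spillTo w w≢j (inj₁ within)
    choose (reserved reserve within⁺) =
      let w , w≢j , even = reserve-escape {C = C} reserve j rich in spillTo w w≢j (inj₂ (even , within⁺))

  defenderWins-safe : ∀ C → Acc _<_ (pebblesT C) → Safe C → DefWinsM H C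
  defenderWins-safe C (acc smaller) sf@(safe nt _) = defM (proj₁ nt) reply
    where
    ih : WinsBelow C
    ih D lt sf′ = defenderWins-safe D (smaller lt) sf′

    reply : ∀ m → Legal H C m → DefWinsD H (apply m C) m
    reply m legal with legal-nonTrivial H {C} nt m legal
    ... | j , i , refl , rich with ≤1-cases (proj₂ nt i)
    ...   | inj₁ empty  = replyToFill sf ih j i rich empty
    ...   | inj₂ single = replyToSpill sf ih j i rich single

lemma3p9 : (s t : ℕ) → 1 ≤ s → 2 ≤ t → (H : SimpleGraph s) → (C : Config s t) →
    NonTrivial C →
    2 ∣ kFree C →
    CT C ≡ kFree C + 2 →
    ((Σ (Fin t) λ x → C (tv x) ≡ 0) ⊎
     (Σ (Fin t) λ x → Σ (Fin t) λ y → ¬ (x ≡ y) × (2 ∣ C (tv x)) × (2 ∣ C (tv y)))) →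
    DefenderWins H C
lemma3p9 s t _ t≥2 H C nonTrivial k-even CT≡k+2 reserve =
  defenderWins-safe C (<-wellFounded (pebblesT C)) (safe nonTrivial (reserved reserve at-budget))
  where
  open Strategy H t≥2
  at-budget : CT C ≤ allowance⁺ (kFree C)
  at-budget = ≤-reflexive (trans CT≡k+2 (sym (allowance⁺-even k-even)))
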